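{- Let $n$ be an odd positive integer, let $g_n(x) = x^{n-1} + x^{n-2} + \cdots + x + 1 \in \mathbb{Z}[x]$, and let $\Phi_4(x) = x^2+1$. Then \[ \operatorname{Rec}(\Phi_4, g_n) = \begin{cases} 1 & \text{if } n \equiv 1 \text{ or } 3 \pmod 8, \\ -1 & \text{if } n \equiv 5 \text{ or } 7 \pmod 8. \end{cases} \]
   Context: A polynomial $g = \sum_{k=0}^N a_k x^k$ is reciprocal if $a_N \ne 0$ and $a_k = a_{N-k}$ for all $k$. If $g$ is reciprocal of degree $2m$, its trace polynomial $g^\#$ is the unique polynomial of degree $m$ with $g(x) = x^m g^\#(x+1/x)$. For example, $\Phi_4^\#(x) = x$. For monic $f, g$, the resultant is $\operatorname{Res}(f,g) := \det(g(C_f))$, where $C_f$ is the companion matrix of $f$. The reciprocant of monic reciprocal even-degree polynomials $f, g$ is $\operatorname{Rec}(f,g) := \operatorname{Res}(f^\#, g^\#)$. -}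

module Defs where

open import Data.Nat as ℕ using (ℕ; zero; suc; _∸_; _≡ᵇ_)
open import Data.Integer using (ℤ; +_; -_; _+_; _*_; -1ℤ; 0ℤ; 1ℤ)
open import Data.Fin using (Fin; zero; suc; toℕ; punchIn)
open import Data.List using (List; []; _∷_; map)
open import Data.Bool using (if_then_else_)
open import Data.Product using (_×_)
open import Relation.Binary.PropositionalEquality using (_≡_; _≢_)

-- Polynomials over ℤ: coefficient lists, lowest degree first.

Poly : Set
Poly = List ℤ

coeff : Poly → ℕ → ℤ
coeff []       _       = 0ℤ
coeff (a ∷ _)  zero    = a
coeff (_ ∷ p)  (suc k) = coeff p k

-- equality of polynomials (coefficientwise; trailing zeros irrelevant)
_≈ₚ_ : Poly → Poly → Set
p ≈ₚ q = ∀ k → coeff p k ≡ coeff q k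

HasDegree : Poly → ℕ → Set
HasDegree p d = (coeff p d ≢ 0ℤ) × (∀ k → d ℕ.< k → coeff p k ≡ 0ℤ)

_+ₚ_ : Poly → Poly → Poly
[]      +ₚ q       = q
(a ∷ p) +ₚ []      = a ∷ p
(a ∷ p) +ₚ (b ∷ q) = (a + b) ∷ (p +ₚ q)

_*ₚ_ : Poly → Poly → Poly
[]      *ₚ q = []
(a ∷ p) *ₚ q = map (a *_) q +ₚ (0ℤ ∷ (p *ₚ q))

X : Poly
X = 0ℤ ∷ 1ℤ ∷ []

constₚ : ℤ → Poly
constₚ c = c ∷ []

_^ₚ_ : Poly → ℕ → Poly
p ^ₚ zero  = constₚ 1ℤ
p ^ₚ suc k = p *ₚ (p ^ₚ k)

sumₚ : ℕ → (ℕ → Poly) → Poly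
sumₚ zero    f = []
sumₚ (suc n) f = sumₚ n f +ₚ f n

IsReciprocal : Poly → ℕ → Set
IsReciprocal g N = HasDegree g N × (∀ k → k ℕ.≤ N → coeff g k ≡ coeff g (N ∸ k))

-- x^m h(x + 1/x) = Σ_{k=0}^{m} h_k x^(m-k) (x^2+1)^k
traceSubst : Poly → ℕ → Poly
traceSubst h m =
  sumₚ (suc m) (λ k → constₚ (coeff h k) *ₚ ((X ^ₚ (m ∸ k)) *ₚ (((X *ₚ X) +ₚ constₚ 1ℤ) ^ₚ k)))

IsTracePoly : Poly → ℕ → Poly → Set
IsTracePoly g m h = HasDegree h m × (g ≈ₚ traceSubst h m)

Mat : ℕ → Set
Mat n = Fin n → Fin n → ℤ

sumFin : ∀ {n} → (Fin n → ℤ) → ℤ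
sumFin {zero}  f = 0ℤ
sumFin {suc n} f = f zero + sumFin (λ i → f (suc i))

_⊕_ : ∀ {n} → Mat n → Mat n → Mat n
(A ⊕ B) i j = A i j + B i j

_⊗_ : ∀ {n} → Mat n → Mat n → Mat n
(A ⊗ B) i j = sumFin (λ l → A i l * B l j)

scalarMat : ∀ {n} → ℤ → Mat n
scalarMat c i j = if toℕ i ≡ᵇ toℕ j then c else 0ℤ

sign : ℕ → ℤ
sign zero    = 1ℤ
sign (suc k) = - sign k

det : ∀ {n} → Mat n → ℤ
det {zero}  A = 1ℤ
det {suc n} A = sumFin (λ j → sign (toℕ j) * (A zero j * det (λ i l → A (suc i) (punchIn j l))))

evalMat : ∀ {n} → Poly → Mat n → Mat n
evalMat []      A = scalarMat 0ℤ
evalMat (a ∷ p) A = scalarMat a ⊕ (A ⊗ evalMat p A)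

companion : Poly → (d : ℕ) → Mat d
companion f d i j =
  (if toℕ i ≡ᵇ suc (toℕ j) then 1ℤ else 0ℤ)
  + (if toℕ j ≡ᵇ (d ∸ 1) then - coeff f (toℕ i) else 0ℤ)

-- Res(f, g) = det(g(C_f)) for f monic of degree d
Res : Poly → (d : ℕ) → Poly → ℤ
Res f d g = det (evalMat g (companion f d))

Φ₄ : Poly
Φ₄ = 1ℤ ∷ 0ℤ ∷ 1ℤ ∷ []

gpoly : ℕ → Poly
gpoly zero    = []
gpoly (suc n) = 1ℤ ∷ gpoly n

-- Since i + 1/i = 0, the identity g(x) = x^m g^#(x + 1/x)
-- gives g(i) = i^m g^#(0) for every trace polynomial, and g^#(0) is exactly Rec(Φ₄, g) because
-- Φ₄^# = x. For g = g_{2m+1} the value g(i) = 1 + i + ... + i^(2m) and i^m are both 4-periodic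
-- in m, so g^#(0) = ±1 can be read off from m = 0, 1, 2, 3. Existence of the trace polynomial
-- of g_{2m+1} comes from the recurrence g_{n+4} = (x² + 1) g_{n+2} − x² g_n, which translates
-- into the Chebyshev-type recurrence s_{m+2} = x s_{m+1} − s_m.
module Submission where

open import Defs
open import Data.Nat as ℕ using (ℕ; zero; suc; _∸_; _%_; _≤_; _<_; s≤s)
import Data.Nat.Properties as ℕₚ
open import Data.Nat.DivMod using ([m+n]%n≡m%n)
import Data.Nat.Tactic.RingSolver as ℕ-Solver
open import Data.Integer using (ℤ; -_; 0ℤ; 1ℤ; -1ℤ)
import Data.Integer.Properties as ℤₚ
open import Data.Integer.Tactic.RingSolver using (solve; solve-∀)
open import Data.Fin using (zero)
open import Data.List using ([]; _∷_; map)
open import Data.Product using (_×_; _,_; proj₁; proj₂; ∃)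
open import Data.Sum using (_⊎_; inj₁; inj₂)
open import Relation.Binary.Bundles using (Setoid)
import Relation.Binary.Reasoning.Setoid as SetoidReasoning
open import Relation.Binary.PropositionalEquality

module IntegerSums where
  open import Data.Integer using (_+_; _*_)
  open import Algebra.Properties.CommutativeSemigroup ℤₚ.+-commutativeSemigroup using (interchange)

  sumℤ : ℕ → (ℕ → ℤ) → ℤ
  sumℤ zero    f = 0ℤ
  sumℤ (suc n) f = sumℤ n f + f n

  sumℤ-cong-< : ∀ n {f g : ℕ → ℤ} → (∀ j → j < n → f j ≡ g j) → sumℤ n f ≡ sumℤ n g
  sumℤ-cong-< zero    eq = refl
  sumℤ-cong-< (suc n) eq =
    cong₂ _+_ (sumℤ-cong-< n (λ j j<n → eq j (ℕₚ.m<n⇒m<1+n j<n))) (eq n (ℕₚ.n<1+n n))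

  sumℤ-cong : ∀ n {f g : ℕ → ℤ} → (∀ j → f j ≡ g j) → sumℤ n f ≡ sumℤ n g
  sumℤ-cong n eq = sumℤ-cong-< n (λ j _ → eq j)

  sumℤ-zero : ∀ n {f : ℕ → ℤ} → (∀ j → f j ≡ 0ℤ) → sumℤ n f ≡ 0ℤ
  sumℤ-zero zero    eq = refl
  sumℤ-zero (suc n) eq = cong₂ _+_ (sumℤ-zero n eq) (eq n)

  sumℤ-distrib-+ : ∀ n (f g : ℕ → ℤ) → sumℤ n (λ j → f j + g j) ≡ sumℤ n f + sumℤ n g
  sumℤ-distrib-+ zero    f g = refl
  sumℤ-distrib-+ (suc n) f g =
    trans (cong (_+ (f n + g n)) (sumℤ-distrib-+ n f g)) (interchange (sumℤ n f) (sumℤ n g) (f n) (g n))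

  sumℤ-distribˡ-* : ∀ n c (f : ℕ → ℤ) → sumℤ n (λ j → c * f j) ≡ c * sumℤ n f
  sumℤ-distribˡ-* zero    c f = sym (ℤₚ.*-zeroʳ c)
  sumℤ-distribˡ-* (suc n) c f =
    trans (cong (_+ c * f n) (sumℤ-distribˡ-* n c f)) (sym (ℤₚ.*-distribˡ-+ c (sumℤ n f) (f n)))

  sumℤ-suc : ∀ n (f : ℕ → ℤ) → sumℤ (suc n) f ≡ f 0 + sumℤ n (λ j → f (suc j))
  sumℤ-suc zero    f = trans (ℤₚ.+-identityˡ (f 0)) (sym (ℤₚ.+-identityʳ (f 0)))
  sumℤ-suc (suc n) f =
    trans (cong (_+ f (suc n)) (sumℤ-suc n f)) (ℤₚ.+-assoc (f 0) (sumℤ n (λ j → f (suc j))) (f (suc n)))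

module PolynomialAlgebra where
  open import Data.Integer using (_+_; _*_)
  open import Algebra.Properties.CommutativeSemigroup ℤₚ.+-commutativeSemigroup using (interchange)

  infix 4 _≋_

  -- _≈ₚ_ wrapped in a record, so that Agda can infer the polynomials from an equation's type.
  record _≋_ (p q : Poly) : Set where
    constructor coeffwise
    field coeff-≡ : p ≈ₚ q

  open _≋_ public

  ≋-setoid : Setoid _ _
  ≋-setoid = record
    { Carrier       = Poly
    ; _≈_           = _≋_
    ; isEquivalence = record
      { refl  = coeffwise λ _ → refl
      ; sym   = λ p≋q → coeffwise λ n → sym (coeff-≡ p≋q n)
      ; trans = λ p≋q q≋r → coeffwise λ n → trans (coeff-≡ p≋q n) (coeff-≡ q≋r n)
      }
    }

  open Setoid ≋-setoid public using () renaming (refl to ≋-refl; sym to ≋-sym; trans to ≋-trans)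

  coeff-+ₚ : ∀ p q n → coeff (p +ₚ q) n ≡ coeff p n + coeff q n
  coeff-+ₚ []      q       n       = sym (ℤₚ.+-identityˡ _)
  coeff-+ₚ (a ∷ p) []      n       = sym (ℤₚ.+-identityʳ _)
  coeff-+ₚ (a ∷ p) (b ∷ q) zero    = refl
  coeff-+ₚ (a ∷ p) (b ∷ q) (suc n) = coeff-+ₚ p q n

  coeff-scale : ∀ a q n → coeff (map (a *_) q) n ≡ a * coeff q n
  coeff-scale a []      n       = sym (ℤₚ.*-zeroʳ a)
  coeff-scale a (b ∷ q) zero    = refl
  coeff-scale a (b ∷ q) (suc n) = coeff-scale a q n

  ∷-cong : ∀ {a b p q} → a ≡ b → p ≋ q → (a ∷ p) ≋ (b ∷ q)
  ∷-cong a≡b p≋q = coeffwise λ { zero → a≡b ; (suc n) → coeff-≡ p≋q n }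

  ∷-zero : ∀ {p} → p ≋ [] → (0ℤ ∷ p) ≋ []
  ∷-zero p≋0 = coeffwise λ { zero → refl ; (suc n) → coeff-≡ p≋0 n }

  ∷-tail : ∀ {a b p q} → (a ∷ p) ≋ (b ∷ q) → p ≋ q
  ∷-tail ap≋bq = coeffwise λ n → coeff-≡ ap≋bq (suc n)

  +ₚ-cong : ∀ {p p′ q q′} → p ≋ p′ → q ≋ q′ → (p +ₚ q) ≋ (p′ +ₚ q′)
  +ₚ-cong {p} {p′} {q} {q′} p≋p′ q≋q′ = coeffwise λ n →
    trans (coeff-+ₚ p q n)
          (trans (cong₂ _+_ (coeff-≡ p≋p′ n) (coeff-≡ q≋q′ n)) (sym (coeff-+ₚ p′ q′ n)))

  +ₚ-identityʳ : ∀ p → (p +ₚ []) ≋ p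
  +ₚ-identityʳ []      = ≋-refl
  +ₚ-identityʳ (a ∷ p) = ≋-refl

  +ₚ-interchange : ∀ p q r s → ((p +ₚ q) +ₚ (r +ₚ s)) ≋ ((p +ₚ r) +ₚ (q +ₚ s))
  +ₚ-interchange p q r s = coeffwise λ n → begin
    coeff ((p +ₚ q) +ₚ (r +ₚ s)) n
      ≡⟨ trans (coeff-+ₚ (p +ₚ q) (r +ₚ s) n) (cong₂ _+_ (coeff-+ₚ p q n) (coeff-+ₚ r s n)) ⟩
    (coeff p n + coeff q n) + (coeff r n + coeff s n)
      ≡⟨ interchange (coeff p n) (coeff q n) (coeff r n) (coeff s n) ⟩
    (coeff p n + coeff r n) + (coeff q n + coeff s n)
      ≡⟨ sym (trans (coeff-+ₚ (p +ₚ r) (q +ₚ s) n) (cong₂ _+_ (coeff-+ₚ p r n) (coeff-+ₚ q s n))) ⟩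
    coeff ((p +ₚ r) +ₚ (q +ₚ s)) n ∎
    where open ≡-Reasoning

  scale-cong : ∀ a {p q} → p ≋ q → map (a *_) p ≋ map (a *_) q
  scale-cong a {p} {q} p≋q = coeffwise λ n →
    trans (coeff-scale a p n) (trans (cong (a *_) (coeff-≡ p≋q n)) (sym (coeff-scale a q n)))

  scale-zero : ∀ {a} q → a ≡ 0ℤ → map (a *_) q ≋ []
  scale-zero q refl = coeffwise λ n → trans (coeff-scale 0ℤ q n) (ℤₚ.*-zeroˡ (coeff q n))

  scale-one : ∀ q → map (1ℤ *_) q ≋ q
  scale-one q = coeffwise λ n → trans (coeff-scale 1ℤ q n) (ℤₚ.*-identityˡ (coeff q n))

  scale-distrib-+ₚ : ∀ a p q → map (a *_) (p +ₚ q) ≋ (map (a *_) p +ₚ map (a *_) q)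
  scale-distrib-+ₚ a p q = coeffwise λ n → begin
    coeff (map (a *_) (p +ₚ q)) n   ≡⟨ trans (coeff-scale a (p +ₚ q) n) (cong (a *_) (coeff-+ₚ p q n)) ⟩
    a * (coeff p n + coeff q n)     ≡⟨ ℤₚ.*-distribˡ-+ a (coeff p n) (coeff q n) ⟩
    a * coeff p n + a * coeff q n   ≡⟨ sym (trans (coeff-+ₚ (map (a *_) p) (map (a *_) q) n)
                                                 (cong₂ _+_ (coeff-scale a p n) (coeff-scale a q n))) ⟩
    coeff (map (a *_) p +ₚ map (a *_) q) n ∎
    where open ≡-Reasoning

  constₚ-*ₚ : ∀ c q → (constₚ c *ₚ q) ≋ map (c *_) q
  constₚ-*ₚ c q = ≋-trans (+ₚ-cong ≋-refl (∷-zero ≋-refl)) (+ₚ-identityʳ (map (c *_) q))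

  *ₚ-zeroˡ : ∀ {p} q → p ≋ [] → (p *ₚ q) ≋ []
  *ₚ-zeroˡ {[]}    q p≋0 = ≋-refl
  *ₚ-zeroˡ {a ∷ p} q p≋0 =
    +ₚ-cong (scale-zero q (coeff-≡ p≋0 0)) (∷-zero (*ₚ-zeroˡ {p} q (coeffwise λ n → coeff-≡ p≋0 (suc n))))

  *ₚ-congˡ : ∀ {p p′} q → p ≋ p′ → (p *ₚ q) ≋ (p′ *ₚ q)
  *ₚ-congˡ {[]}    {p′}      q p≋p′ = ≋-sym (*ₚ-zeroˡ q (≋-sym p≋p′))
  *ₚ-congˡ {a ∷ p} {[]}      q p≋p′ = *ₚ-zeroˡ q p≋p′
  *ₚ-congˡ {a ∷ p} {a′ ∷ p′} q p≋p′ rewrite coeff-≡ p≋p′ 0 =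
    +ₚ-cong ≋-refl (∷-cong refl (*ₚ-congˡ q (∷-tail p≋p′)))

  *ₚ-congʳ : ∀ p {q q′} → q ≋ q′ → (p *ₚ q) ≋ (p *ₚ q′)
  *ₚ-congʳ []      q≋q′ = ≋-refl
  *ₚ-congʳ (a ∷ p) q≋q′ = +ₚ-cong (scale-cong a q≋q′) (∷-cong refl (*ₚ-congʳ p q≋q′))

  *ₚ-distribˡ-+ₚ : ∀ p q r → (p *ₚ (q +ₚ r)) ≋ ((p *ₚ q) +ₚ (p *ₚ r))
  *ₚ-distribˡ-+ₚ []      q r = ≋-refl
  *ₚ-distribˡ-+ₚ (a ∷ p) q r = begin
    map (a *_) (q +ₚ r) +ₚ (0ℤ ∷ (p *ₚ (q +ₚ r)))
      ≈⟨ +ₚ-cong (scale-distrib-+ₚ a q r) (∷-cong refl (*ₚ-distribˡ-+ₚ p q r)) ⟩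
    (map (a *_) q +ₚ map (a *_) r) +ₚ ((0ℤ ∷ (p *ₚ q)) +ₚ (0ℤ ∷ (p *ₚ r)))
      ≈⟨ +ₚ-interchange (map (a *_) q) (map (a *_) r) (0ℤ ∷ (p *ₚ q)) (0ℤ ∷ (p *ₚ r)) ⟩
    (map (a *_) q +ₚ (0ℤ ∷ (p *ₚ q))) +ₚ (map (a *_) r +ₚ (0ℤ ∷ (p *ₚ r))) ∎
    where open SetoidReasoning ≋-setoid

  *ₚ-shiftˡ : ∀ p q → ((0ℤ ∷ p) *ₚ q) ≋ (0ℤ ∷ (p *ₚ q))
  *ₚ-shiftˡ p q = +ₚ-cong (scale-zero q refl) ≋-refl

  *ₚ-shiftʳ : ∀ p q → (p *ₚ (0ℤ ∷ q)) ≋ (0ℤ ∷ (p *ₚ q))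
  *ₚ-shiftʳ []      q = ≋-sym (∷-zero ≋-refl)
  *ₚ-shiftʳ (a ∷ p) q =
    ∷-cong (trans (ℤₚ.+-identityʳ (a * 0ℤ)) (ℤₚ.*-zeroʳ a)) (+ₚ-cong ≋-refl (*ₚ-shiftʳ p q))

  X-*ₚ : ∀ q → (X *ₚ q) ≋ (0ℤ ∷ q)
  X-*ₚ q = ≋-trans (*ₚ-shiftˡ (constₚ 1ℤ) q) (∷-cong refl (≋-trans (constₚ-*ₚ 1ℤ q) (scale-one q)))

  X²+1 : Poly
  X²+1 = (X *ₚ X) +ₚ constₚ 1ℤ

  X²+1-*ₚ : ∀ q → (X²+1 *ₚ q) ≋ (q +ₚ (0ℤ ∷ 0ℤ ∷ q))
  X²+1-*ₚ q = +ₚ-cong (scale-one q) (∷-cong refl (X-*ₚ q))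

  X²+1-cong : ∀ {p q} → p ≋ q → (p +ₚ (0ℤ ∷ 0ℤ ∷ p)) ≋ (q +ₚ (0ℤ ∷ 0ℤ ∷ q))
  X²+1-cong p≋q = +ₚ-cong p≋q (∷-cong refl (∷-cong refl p≋q))

  *ₚ-X : ∀ p q → ((X *ₚ p) *ₚ q) ≋ (0ℤ ∷ (p *ₚ q))
  *ₚ-X p q = ≋-trans (*ₚ-congˡ q (X-*ₚ p)) (*ₚ-shiftˡ p q)

  *ₚ-X²+1 : ∀ p q → (p *ₚ (X²+1 *ₚ q)) ≋ ((p *ₚ q) +ₚ (0ℤ ∷ 0ℤ ∷ (p *ₚ q)))
  *ₚ-X²+1 p q = begin
    p *ₚ (X²+1 *ₚ q)                   ≈⟨ *ₚ-congʳ p (X²+1-*ₚ q) ⟩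
    p *ₚ (q +ₚ (0ℤ ∷ 0ℤ ∷ q))          ≈⟨ *ₚ-distribˡ-+ₚ p q (0ℤ ∷ 0ℤ ∷ q) ⟩
    (p *ₚ q) +ₚ (p *ₚ (0ℤ ∷ 0ℤ ∷ q))   ≈⟨ +ₚ-cong ≋-refl (*ₚ-shiftʳ p (0ℤ ∷ q)) ⟩
    (p *ₚ q) +ₚ (0ℤ ∷ (p *ₚ (0ℤ ∷ q))) ≈⟨ +ₚ-cong ≋-refl (∷-cong refl (*ₚ-shiftʳ p q)) ⟩
    (p *ₚ q) +ₚ (0ℤ ∷ 0ℤ ∷ (p *ₚ q))   ∎
    where open SetoidReasoning ≋-setoid

module LinearCombinations where
  open import Data.Integer using (_+_; _*_)
  open IntegerSums
  open PolynomialAlgebra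

  lincomb : ℕ → (ℕ → ℤ) → (ℕ → Poly) → Poly
  lincomb n u P = sumₚ n (λ j → constₚ (u j) *ₚ P j)

  coeff-lincomb : ∀ n u P i → coeff (lincomb n u P) i ≡ sumℤ n (λ j → u j * coeff (P j) i)
  coeff-lincomb zero    u P i = refl
  coeff-lincomb (suc n) u P i =
    trans (coeff-+ₚ (lincomb n u P) (constₚ (u n) *ₚ P n) i)
          (cong₂ _+_ (coeff-lincomb n u P i)
                     (trans (coeff-≡ (constₚ-*ₚ (u n) (P n)) i) (coeff-scale (u n) (P n) i)))

  lincomb-congˡ : ∀ n {u v} P → (∀ j → u j ≡ v j) → lincomb n u P ≋ lincomb n v P
  lincomb-congˡ n {u} {v} P u≗v = coeffwise λ i → begin
    coeff (lincomb n u P) i              ≡⟨ coeff-lincomb n u P i ⟩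
    sumℤ n (λ j → u j * coeff (P j) i)   ≡⟨ sumℤ-cong n (λ j → cong (_* coeff (P j) i) (u≗v j)) ⟩
    sumℤ n (λ j → v j * coeff (P j) i)   ≡⟨ coeff-lincomb n v P i ⟨
    coeff (lincomb n v P) i              ∎
    where open ≡-Reasoning

  lincomb-congʳ-< : ∀ n u {P Q} → (∀ j → j < n → P j ≋ Q j) → lincomb n u P ≋ lincomb n u Q
  lincomb-congʳ-< n u {P} {Q} P≋Q = coeffwise λ i → begin
    coeff (lincomb n u P) i              ≡⟨ coeff-lincomb n u P i ⟩
    sumℤ n (λ j → u j * coeff (P j) i)
      ≡⟨ sumℤ-cong-< n (λ j j<n → cong (u j *_) (coeff-≡ (P≋Q j j<n) i)) ⟩
    sumℤ n (λ j → u j * coeff (Q j) i)   ≡⟨ coeff-lincomb n u Q i ⟨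
    coeff (lincomb n u Q) i              ∎
    where open ≡-Reasoning

  lincomb-+ˡ : ∀ n u v P → lincomb n (λ j → u j + v j) P ≋ (lincomb n u P +ₚ lincomb n v P)
  lincomb-+ˡ n u v P = coeffwise λ i → begin
    coeff (lincomb n (λ j → u j + v j) P) i
      ≡⟨ coeff-lincomb n (λ j → u j + v j) P i ⟩
    sumℤ n (λ j → (u j + v j) * coeff (P j) i)
      ≡⟨ sumℤ-cong n (λ j → ℤₚ.*-distribʳ-+ (coeff (P j) i) (u j) (v j)) ⟩
    sumℤ n (λ j → u j * coeff (P j) i + v j * coeff (P j) i)
      ≡⟨ sumℤ-distrib-+ n (λ j → u j * coeff (P j) i) (λ j → v j * coeff (P j) i) ⟩
    sumℤ n (λ j → u j * coeff (P j) i) + sumℤ n (λ j → v j * coeff (P j) i)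
      ≡⟨ cong₂ _+_ (coeff-lincomb n u P i) (coeff-lincomb n v P i) ⟨
    coeff (lincomb n u P) i + coeff (lincomb n v P) i
      ≡⟨ coeff-+ₚ (lincomb n u P) (lincomb n v P) i ⟨
    coeff (lincomb n u P +ₚ lincomb n v P) i ∎
    where open ≡-Reasoning

  lincomb-+ʳ : ∀ n u P Q → lincomb n u (λ j → P j +ₚ Q j) ≋ (lincomb n u P +ₚ lincomb n u Q)
  lincomb-+ʳ n u P Q = coeffwise λ i → begin
    coeff (lincomb n u (λ j → P j +ₚ Q j)) i
      ≡⟨ coeff-lincomb n u (λ j → P j +ₚ Q j) i ⟩
    sumℤ n (λ j → u j * coeff (P j +ₚ Q j) i)
      ≡⟨ sumℤ-cong n (λ j → trans (cong (u j *_) (coeff-+ₚ (P j) (Q j) i))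
                                  (ℤₚ.*-distribˡ-+ (u j) (coeff (P j) i) (coeff (Q j) i))) ⟩
    sumℤ n (λ j → u j * coeff (P j) i + u j * coeff (Q j) i)
      ≡⟨ sumℤ-distrib-+ n (λ j → u j * coeff (P j) i) (λ j → u j * coeff (Q j) i) ⟩
    sumℤ n (λ j → u j * coeff (P j) i) + sumℤ n (λ j → u j * coeff (Q j) i)
      ≡⟨ cong₂ _+_ (coeff-lincomb n u P i) (coeff-lincomb n u Q i) ⟨
    coeff (lincomb n u P) i + coeff (lincomb n u Q) i
      ≡⟨ coeff-+ₚ (lincomb n u P) (lincomb n u Q) i ⟨
    coeff (lincomb n u P +ₚ lincomb n u Q) i ∎
    where open ≡-Reasoning

  lincomb-scale : ∀ n c u P → lincomb n (λ j → c * u j) P ≋ map (c *_) (lincomb n u P)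
  lincomb-scale n c u P = coeffwise λ i → begin
    coeff (lincomb n (λ j → c * u j) P) i
      ≡⟨ coeff-lincomb n (λ j → c * u j) P i ⟩
    sumℤ n (λ j → c * u j * coeff (P j) i)
      ≡⟨ sumℤ-cong n (λ j → ℤₚ.*-assoc c (u j) (coeff (P j) i)) ⟩
    sumℤ n (λ j → c * (u j * coeff (P j) i))
      ≡⟨ sumℤ-distribˡ-* n c (λ j → u j * coeff (P j) i) ⟩
    c * sumℤ n (λ j → u j * coeff (P j) i)
      ≡⟨ cong (c *_) (coeff-lincomb n u P i) ⟨
    c * coeff (lincomb n u P) i
      ≡⟨ coeff-scale c (lincomb n u P) i ⟨
    coeff (map (c *_) (lincomb n u P)) i ∎
    where open ≡-Reasoning

  lincomb-∷0 : ∀ n u P → lincomb n u (λ j → 0ℤ ∷ P j) ≋ (0ℤ ∷ lincomb n u P)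
  lincomb-∷0 n u P = coeffwise λ
    { zero    → trans (coeff-lincomb n u (λ j → 0ℤ ∷ P j) 0) (sumℤ-zero n (λ j → ℤₚ.*-zeroʳ (u j)))
    ; (suc i) → trans (coeff-lincomb n u (λ j → 0ℤ ∷ P j) (suc i)) (sym (coeff-lincomb n u P i))
    }

  lincomb-tail : ∀ n u P → u 0 ≡ 0ℤ →
                 lincomb (suc n) u P ≋ lincomb n (λ j → u (suc j)) (λ j → P (suc j))
  lincomb-tail n u P u₀≡0 = coeffwise λ i → begin
    coeff (lincomb (suc n) u P) i             ≡⟨ coeff-lincomb (suc n) u P i ⟩
    sumℤ (suc n) (λ j → u j * coeff (P j) i)  ≡⟨ sumℤ-suc n _ ⟩
    u 0 * coeff (P 0) i + rest i              ≡⟨ cong (λ c → c * coeff (P 0) i + rest i) u₀≡0 ⟩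
    0ℤ * coeff (P 0) i + rest i               ≡⟨ cong (_+ rest i) (ℤₚ.*-zeroˡ (coeff (P 0) i)) ⟩
    0ℤ + rest i                               ≡⟨ ℤₚ.+-identityˡ (rest i) ⟩
    rest i                                    ≡⟨ coeff-lincomb n (λ j → u (suc j)) (λ j → P (suc j)) i ⟨
    coeff (lincomb n (λ j → u (suc j)) (λ j → P (suc j))) i ∎
    where
    open ≡-Reasoning
    rest : ℕ → ℤ
    rest i = sumℤ n (λ j → u (suc j) * coeff (P (suc j)) i)

  lincomb-init : ∀ n u P → u n ≡ 0ℤ → lincomb (suc n) u P ≋ lincomb n u P
  lincomb-init n u P uₙ≡0 =
    ≋-trans (+ₚ-cong ≋-refl (≋-trans (constₚ-*ₚ (u n) (P n)) (scale-zero (P n) uₙ≡0)))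
            (+ₚ-identityʳ (lincomb n u P))

module TraceSubstitution where
  open import Data.Integer using (_*_)
  open PolynomialAlgebra
  open LinearCombinations

  -- traceSubst h m is definitionally lincomb (suc m) (coeff h) (traceTerm m).
  traceTerm : ℕ → ℕ → Poly
  traceTerm m j = (X ^ₚ (m ∸ j)) *ₚ (X²+1 ^ₚ j)

  traceTerm-suc-suc : ∀ m j → traceTerm (suc m) (suc j) ≋ (traceTerm m j +ₚ (0ℤ ∷ 0ℤ ∷ traceTerm m j))
  traceTerm-suc-suc m j = *ₚ-X²+1 (X ^ₚ (m ∸ j)) (X²+1 ^ₚ j)

  traceTerm-suc : ∀ {m j} → j ≤ m → traceTerm (suc m) j ≋ (0ℤ ∷ traceTerm m j)
  traceTerm-suc {m} {j} j≤m rewrite ℕₚ.+-∸-assoc 1 j≤m = *ₚ-X (X ^ₚ (m ∸ j)) (X²+1 ^ₚ j)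

  traceSubst-+ₚ : ∀ h₁ h₂ m → traceSubst (h₁ +ₚ h₂) m ≋ (traceSubst h₁ m +ₚ traceSubst h₂ m)
  traceSubst-+ₚ h₁ h₂ m =
    ≋-trans (lincomb-congˡ (suc m) (traceTerm m) (coeff-+ₚ h₁ h₂))
            (lincomb-+ˡ (suc m) (coeff h₁) (coeff h₂) (traceTerm m))

  traceSubst-scale : ∀ a h m → traceSubst (map (a *_) h) m ≋ map (a *_) (traceSubst h m)
  traceSubst-scale a h m =
    ≋-trans (lincomb-congˡ (suc m) (traceTerm m) (coeff-scale a h))
            (lincomb-scale (suc m) a (coeff h) (traceTerm m))

  traceSubst-∷0 : ∀ h m →
    traceSubst (0ℤ ∷ h) (suc m) ≋ (traceSubst h m +ₚ (0ℤ ∷ 0ℤ ∷ traceSubst h m))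
  traceSubst-∷0 h m = begin
    lincomb (suc (suc m)) (coeff (0ℤ ∷ h)) (traceTerm (suc m))
      ≈⟨ lincomb-tail (suc m) (coeff (0ℤ ∷ h)) (traceTerm (suc m)) refl ⟩
    lincomb (suc m) (coeff h) (λ j → traceTerm (suc m) (suc j))
      ≈⟨ lincomb-congʳ-< (suc m) (coeff h) (λ j _ → traceTerm-suc-suc m j) ⟩
    lincomb (suc m) (coeff h) (λ j → traceTerm m j +ₚ (0ℤ ∷ 0ℤ ∷ traceTerm m j))
      ≈⟨ lincomb-+ʳ (suc m) (coeff h) (traceTerm m) (λ j → 0ℤ ∷ 0ℤ ∷ traceTerm m j) ⟩
    traceSubst h m +ₚ lincomb (suc m) (coeff h) (λ j → 0ℤ ∷ 0ℤ ∷ traceTerm m j)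
      ≈⟨ +ₚ-cong ≋-refl (≋-trans (lincomb-∷0 (suc m) (coeff h) (λ j → 0ℤ ∷ traceTerm m j))
                                   (∷-cong refl (lincomb-∷0 (suc m) (coeff h) (traceTerm m)))) ⟩
    traceSubst h m +ₚ (0ℤ ∷ 0ℤ ∷ traceSubst h m) ∎
    where open SetoidReasoning ≋-setoid

  traceSubst-suc : ∀ h m → coeff h (suc m) ≡ 0ℤ → traceSubst h (suc m) ≋ (0ℤ ∷ traceSubst h m)
  traceSubst-suc h m h₁₊ₘ≡0 = begin
    lincomb (suc (suc m)) (coeff h) (traceTerm (suc m))
      ≈⟨ lincomb-init (suc m) (coeff h) (traceTerm (suc m)) h₁₊ₘ≡0 ⟩
    lincomb (suc m) (coeff h) (traceTerm (suc m))
      ≈⟨ lincomb-congʳ-< (suc m) (coeff h) (λ { j (s≤s j≤m) → traceTerm-suc j≤m }) ⟩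
    lincomb (suc m) (coeff h) (λ j → 0ℤ ∷ traceTerm m j)
      ≈⟨ lincomb-∷0 (suc m) (coeff h) (traceTerm m) ⟩
    0ℤ ∷ traceSubst h m ∎
    where open SetoidReasoning ≋-setoid

module TracePolynomialOfGeometricSum where
  open import Data.Integer using (_+_; _*_)
  open PolynomialAlgebra
  open TraceSubstitution

  geomTrace : ℕ → Poly
  geomTrace zero          = 1ℤ ∷ []
  geomTrace (suc zero)    = 1ℤ ∷ 1ℤ ∷ []
  geomTrace (suc (suc k)) = (0ℤ ∷ geomTrace (suc k)) +ₚ map (-1ℤ *_) (geomTrace k)

  Monic : Poly → ℕ → Set
  Monic p d = coeff p d ≡ 1ℤ × (∀ j → d < j → coeff p j ≡ 0ℤ)

  Monic⇒HasDegree : ∀ {p d} → Monic p d → HasDegree p d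
  Monic⇒HasDegree (lead≡1 , above) = (λ lead≡0 → 1≢0 (trans (sym lead≡1) lead≡0)) , above
    where
    1≢0 : 1ℤ ≢ 0ℤ
    1≢0 ()

  Monic-∷ : ∀ {d} a p → Monic p d → Monic (a ∷ p) (suc d)
  Monic-∷ a p (lead≡1 , above) = lead≡1 , λ { (suc j) (s≤s d<j) → above j d<j }

  Monic-+ₚ-lower : ∀ p q {d} → Monic p d → (∀ j → d ≤ j → coeff q j ≡ 0ℤ) → Monic (p +ₚ q) d
  Monic-+ₚ-lower p q {d} (lead≡1 , above) q-vanishes =
      trans (coeff-+ₚ p q d) (cong₂ _+_ lead≡1 (q-vanishes d ℕₚ.≤-refl))
    , λ j d<j → trans (coeff-+ₚ p q j) (cong₂ _+_ (above j d<j) (q-vanishes j (ℕₚ.<⇒≤ d<j)))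

  geomTrace-monic : ∀ k → Monic (geomTrace k) k
  geomTrace-monic zero          = refl , λ { (suc j) _ → refl }
  geomTrace-monic (suc zero)    = refl , λ { (suc (suc j)) _ → refl ; (suc zero) (s≤s ()) }
  geomTrace-monic (suc (suc k)) =
    Monic-+ₚ-lower (0ℤ ∷ geomTrace (suc k)) (map (-1ℤ *_) (geomTrace k))
                   (Monic-∷ 0ℤ (geomTrace (suc k)) (geomTrace-monic (suc k)))
                   (λ j k+2≤j → trans (coeff-scale -1ℤ (geomTrace k) j)
                                      (cong (-1ℤ *_) (proj₂ (geomTrace-monic k) j (ℕₚ.<⇒≤ k+2≤j))))

  gpoly-recurrence : ∀ n → gpoly (4 ℕ.+ n) ≋
    ((gpoly (2 ℕ.+ n) +ₚ (0ℤ ∷ 0ℤ ∷ gpoly (2 ℕ.+ n))) +ₚ map (-1ℤ *_) (0ℤ ∷ 0ℤ ∷ gpoly n))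
  gpoly-recurrence n = coeffwise λ
    { zero → refl
    ; (suc zero) → refl
    ; (suc (suc i)) → sym (begin
        coeff ((g +ₚ g₂) +ₚ map (-1ℤ *_) g) i
          ≡⟨ coeff-+ₚ (g +ₚ g₂) (map (-1ℤ *_) g) i ⟩
        coeff (g +ₚ g₂) i + coeff (map (-1ℤ *_) g) i
          ≡⟨ cong₂ _+_ (coeff-+ₚ g g₂ i) (coeff-scale -1ℤ g i) ⟩
        (coeff g i + coeff g₂ i) + -1ℤ * coeff g i
          ≡⟨ cancel (coeff g i) (coeff g₂ i) ⟩
        coeff g₂ i ∎) }
    where
    open ≡-Reasoning
    g = gpoly n
    g₂ = gpoly (2 ℕ.+ n)
    cancel : ∀ a b → (a + b) + -1ℤ * a ≡ b
    cancel = solve-∀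

  gpoly-odd-suc : ∀ k → gpoly (1 ℕ.+ 2 ℕ.* suc k) ≡ gpoly (2 ℕ.+ (1 ℕ.+ 2 ℕ.* k))
  gpoly-odd-suc k = cong (λ m → gpoly (suc m)) (ℕₚ.*-suc 2 k)

  geomTrace-trace-step : ∀ k →
    gpoly (1 ℕ.+ 2 ℕ.* suc k) ≋ traceSubst (geomTrace (suc k)) (suc k) →
    gpoly (1 ℕ.+ 2 ℕ.* k) ≋ traceSubst (geomTrace k) k →
    gpoly (1 ℕ.+ 2 ℕ.* suc (suc k)) ≋ traceSubst (geomTrace (suc (suc k))) (suc (suc k))
  geomTrace-trace-step k ih₁ ih₀ = begin
    gpoly (1 ℕ.+ 2 ℕ.* suc (suc k))
      ≡⟨ trans (gpoly-odd-suc (suc k)) (cong (λ g → 1ℤ ∷ 1ℤ ∷ g) (gpoly-odd-suc k)) ⟩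
    gpoly (4 ℕ.+ n)
      ≈⟨ gpoly-recurrence n ⟩
    (gpoly (2 ℕ.+ n) +ₚ (0ℤ ∷ 0ℤ ∷ gpoly (2 ℕ.+ n))) +ₚ map (-1ℤ *_) (0ℤ ∷ 0ℤ ∷ gpoly n)
      ≈⟨ +ₚ-cong (X²+1-cong (subst (_≋ t₁) (gpoly-odd-suc k) ih₁)) (scale-cong -1ℤ x²g≋t₀) ⟩
    (t₁ +ₚ (0ℤ ∷ 0ℤ ∷ t₁)) +ₚ map (-1ℤ *_) (traceSubst (geomTrace k) (suc (suc k)))
      ≈⟨ +ₚ-cong (traceSubst-∷0 (geomTrace (suc k)) (suc k))
                 (traceSubst-scale -1ℤ (geomTrace k) (suc (suc k))) ⟨
    traceSubst (0ℤ ∷ geomTrace (suc k)) (suc (suc k)) +ₚ traceSubst (map (-1ℤ *_) (geomTrace k)) (suc (suc k))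
      ≈⟨ traceSubst-+ₚ (0ℤ ∷ geomTrace (suc k)) (map (-1ℤ *_) (geomTrace k)) (suc (suc k)) ⟨
    traceSubst (geomTrace (suc (suc k))) (suc (suc k)) ∎
    where
    open SetoidReasoning ≋-setoid
    n = 1 ℕ.+ 2 ℕ.* k
    t₁ = traceSubst (geomTrace (suc k)) (suc k)
    vanishes : ∀ j → k < j → coeff (geomTrace k) j ≡ 0ℤ
    vanishes = proj₂ (geomTrace-monic k)
    x²g≋t₀ : (0ℤ ∷ 0ℤ ∷ gpoly n) ≋ traceSubst (geomTrace k) (suc (suc k))
    x²g≋t₀ = ≋-sym (begin
      traceSubst (geomTrace k) (suc (suc k))
        ≈⟨ traceSubst-suc (geomTrace k) (suc k) (vanishes (suc (suc k)) (ℕₚ.m<n⇒m<1+n (ℕₚ.n<1+n k))) ⟩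
      0ℤ ∷ traceSubst (geomTrace k) (suc k)
        ≈⟨ ∷-cong refl (traceSubst-suc (geomTrace k) k (vanishes (suc k) (ℕₚ.n<1+n k))) ⟩
      0ℤ ∷ 0ℤ ∷ traceSubst (geomTrace k) k
        ≈⟨ ∷-cong refl (∷-cong refl ih₀) ⟨
      0ℤ ∷ 0ℤ ∷ gpoly n ∎)

  geomTrace-trace : ∀ k → gpoly (1 ℕ.+ 2 ℕ.* k) ≋ traceSubst (geomTrace k) k
  geomTrace-trace zero          = coeffwise λ { zero → refl ; (suc i) → refl }
  geomTrace-trace (suc zero)    = coeffwise λ
    { zero → refl ; (suc zero) → refl ; (suc (suc zero)) → refl ; (suc (suc (suc i))) → refl }
  geomTrace-trace (suc (suc k)) = geomTrace-trace-step k (geomTrace-trace (suc k)) (geomTrace-trace k)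

module EvaluationAtI where
  open import Data.Integer using (_+_; _*_; _-_)
  open PolynomialAlgebra
  open LinearCombinations
  open TraceSubstitution

  ℤ[i] : Set
  ℤ[i] = ℤ × ℤ

  infixl 6 _+ᵢ_
  infixl 7 _*ᵢ_ _·ᵢ_
  infixr 8 i·_

  0ᵢ 1ᵢ : ℤ[i]
  0ᵢ = 0ℤ , 0ℤ
  1ᵢ = 1ℤ , 0ℤ

  _+ᵢ_ : ℤ[i] → ℤ[i] → ℤ[i]
  (a , b) +ᵢ (c , d) = a + c , b + d

  _*ᵢ_ : ℤ[i] → ℤ[i] → ℤ[i]
  (a , b) *ᵢ (c , d) = a * c - b * d , a * d + b * c

  _·ᵢ_ : ℤ → ℤ[i] → ℤ[i]
  c ·ᵢ (a , b) = c * a , c * b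

  i·_ : ℤ[i] → ℤ[i]
  i· (a , b) = - b , a

  evalAtI : Poly → ℤ[i]
  evalAtI []      = 0ᵢ
  evalAtI (a ∷ p) = (a , 0ℤ) +ᵢ i· evalAtI p

  +ᵢ-identityˡ : ∀ z → 0ᵢ +ᵢ z ≡ z
  +ᵢ-identityˡ (a , b) = cong₂ _,_ (ℤₚ.+-identityˡ a) (ℤₚ.+-identityˡ b)

  +ᵢ-identityʳ : ∀ z → z +ᵢ 0ᵢ ≡ z
  +ᵢ-identityʳ (a , b) = cong₂ _,_ (ℤₚ.+-identityʳ a) (ℤₚ.+-identityʳ b)

  ·ᵢ-zeroʳ : ∀ c → c ·ᵢ 0ᵢ ≡ 0ᵢ
  ·ᵢ-zeroʳ c = cong₂ _,_ (ℤₚ.*-zeroʳ c) (ℤₚ.*-zeroʳ c)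

  *ᵢ-identityʳ : ∀ z → z *ᵢ 1ᵢ ≡ z
  *ᵢ-identityʳ (a , b) = cong₂ _,_ (solve (a ∷ b ∷ [])) (solve (a ∷ b ∷ []))

  *ᵢ-zeroʳ : ∀ z → z *ᵢ 0ᵢ ≡ 0ᵢ
  *ᵢ-zeroʳ (a , b) = cong₂ _,_ (solve (a ∷ b ∷ [])) (solve (a ∷ b ∷ []))

  *ᵢ-zeroˡ : ∀ z → 0ᵢ *ᵢ z ≡ 0ᵢ
  *ᵢ-zeroˡ (a , b) = cong₂ _,_ (solve (a ∷ b ∷ [])) (solve (a ∷ b ∷ []))

  i·-period : ∀ z → i· i· i· i· z ≡ z
  i·-period (a , b) = cong₂ _,_ (ℤₚ.neg-involutive a) (ℤₚ.neg-involutive b)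

  1+i·-period : ∀ z → 1ᵢ +ᵢ i· (1ᵢ +ᵢ i· (1ᵢ +ᵢ i· (1ᵢ +ᵢ i· z))) ≡ z
  1+i·-period (a , b) = cong₂ _,_ (re a) (im b)
    where
    re : ∀ a → 1ℤ + - (0ℤ + (1ℤ + - (0ℤ + a))) ≡ a
    re = solve-∀
    im : ∀ b → 0ℤ + (1ℤ + - (0ℤ + (1ℤ + - b))) ≡ b
    im = solve-∀

  evalAtI-+ₚ : ∀ p q → evalAtI (p +ₚ q) ≡ evalAtI p +ᵢ evalAtI q
  evalAtI-+ₚ []      q       = sym (+ᵢ-identityˡ (evalAtI q))
  evalAtI-+ₚ (a ∷ p) []      = sym (+ᵢ-identityʳ (evalAtI (a ∷ p)))
  evalAtI-+ₚ (a ∷ p) (b ∷ q) =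
    trans (cong (λ z → (a + b , 0ℤ) +ᵢ i· z) (evalAtI-+ₚ p q)) (horner-+ (evalAtI p) (evalAtI q))
    where
    horner-+ : ∀ z w → (a + b , 0ℤ) +ᵢ i· (z +ᵢ w) ≡ ((a , 0ℤ) +ᵢ i· z) +ᵢ ((b , 0ℤ) +ᵢ i· w)
    horner-+ (c , d) (e , f) = cong₂ _,_ (re a b d f) (im c e)
      where
      re : ∀ a b d f → a + b + - (d + f) ≡ (a + - d) + (b + - f)
      re = solve-∀
      im : ∀ c e → 0ℤ + (c + e) ≡ (0ℤ + c) + (0ℤ + e)
      im = solve-∀

  evalAtI-scale : ∀ a q → evalAtI (map (a *_) q) ≡ a ·ᵢ evalAtI q
  evalAtI-scale a []      = sym (·ᵢ-zeroʳ a)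
  evalAtI-scale a (b ∷ q) =
    trans (cong (λ z → (a * b , 0ℤ) +ᵢ i· z) (evalAtI-scale a q)) (horner-· (evalAtI q))
    where
    horner-· : ∀ z → (a * b , 0ℤ) +ᵢ i· (a ·ᵢ z) ≡ a ·ᵢ ((b , 0ℤ) +ᵢ i· z)
    horner-· (c , d) = cong₂ _,_ (re a b d) (im a c)
      where
      re : ∀ a b d → a * b + - (a * d) ≡ a * (b + - d)
      re = solve-∀
      im : ∀ a c → 0ℤ + a * c ≡ a * (0ℤ + c)
      im = solve-∀

  evalAtI-*ₚ : ∀ p q → evalAtI (p *ₚ q) ≡ evalAtI p *ᵢ evalAtI q
  evalAtI-*ₚ []      q = sym (*ᵢ-zeroˡ (evalAtI q))
  evalAtI-*ₚ (a ∷ p) q = begin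
    evalAtI (map (a *_) q +ₚ (0ℤ ∷ (p *ₚ q)))
      ≡⟨ evalAtI-+ₚ (map (a *_) q) (0ℤ ∷ (p *ₚ q)) ⟩
    evalAtI (map (a *_) q) +ᵢ (0ᵢ +ᵢ i· evalAtI (p *ₚ q))
      ≡⟨ cong₂ (λ z w → z +ᵢ (0ᵢ +ᵢ i· w)) (evalAtI-scale a q) (evalAtI-*ₚ p q) ⟩
    a ·ᵢ evalAtI q +ᵢ (0ᵢ +ᵢ i· (evalAtI p *ᵢ evalAtI q))
      ≡⟨ horner-* (evalAtI p) (evalAtI q) ⟩
    ((a , 0ℤ) +ᵢ i· evalAtI p) *ᵢ evalAtI q ∎
    where
    open ≡-Reasoning
    horner-* : ∀ z w → a ·ᵢ w +ᵢ (0ᵢ +ᵢ i· (z *ᵢ w)) ≡ ((a , 0ℤ) +ᵢ i· z) *ᵢ w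
    horner-* (c , d) (e , f) = cong₂ _,_ (re a c d e f) (im a c d e f)
      where
      re : ∀ a c d e f → a * e + (0ℤ + - (c * f + d * e)) ≡ (a + - d) * e - (0ℤ + c) * f
      re = solve-∀
      im : ∀ a c d e f → a * f + (0ℤ + (c * e - d * f)) ≡ (a + - d) * f + (0ℤ + c) * e
      im = solve-∀

  evalAtI-zero : ∀ {p} → p ≋ [] → evalAtI p ≡ 0ᵢ
  evalAtI-zero {[]}    p≋0 = refl
  evalAtI-zero {a ∷ p} p≋0
    rewrite coeff-≡ p≋0 0 | evalAtI-zero {p} (coeffwise λ n → coeff-≡ p≋0 (suc n)) = refl

  evalAtI-cong : ∀ {p q} → p ≋ q → evalAtI p ≡ evalAtI q
  evalAtI-cong {[]}    {q}     p≋q = sym (evalAtI-zero (≋-sym p≋q))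
  evalAtI-cong {a ∷ p} {[]}    p≋q = evalAtI-zero p≋q
  evalAtI-cong {a ∷ p} {b ∷ q} p≋q rewrite coeff-≡ p≋q 0 | evalAtI-cong (∷-tail p≋q) = refl

  evalAtI-constₚ-*ₚ : ∀ c q → evalAtI (constₚ c *ₚ q) ≡ c ·ᵢ evalAtI q
  evalAtI-constₚ-*ₚ c q = trans (evalAtI-cong (constₚ-*ₚ c q)) (evalAtI-scale c q)

  evalAtI-lincomb : ∀ n u P → (∀ j → evalAtI (P (suc j)) ≡ 0ᵢ) →
                    evalAtI (lincomb (suc n) u P) ≡ u 0 ·ᵢ evalAtI (P 0)
  evalAtI-lincomb zero    u P P₊≡0 = evalAtI-constₚ-*ₚ (u 0) (P 0)
  evalAtI-lincomb (suc n) u P P₊≡0 = begin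
    evalAtI (lincomb (suc n) u P +ₚ (constₚ (u (suc n)) *ₚ P (suc n)))
      ≡⟨ evalAtI-+ₚ (lincomb (suc n) u P) (constₚ (u (suc n)) *ₚ P (suc n)) ⟩
    evalAtI (lincomb (suc n) u P) +ᵢ evalAtI (constₚ (u (suc n)) *ₚ P (suc n))
      ≡⟨ cong₂ _+ᵢ_ (evalAtI-lincomb n u P P₊≡0)
                    (trans (evalAtI-constₚ-*ₚ (u (suc n)) (P (suc n)))
                           (trans (cong (u (suc n) ·ᵢ_) (P₊≡0 n)) (·ᵢ-zeroʳ (u (suc n))))) ⟩
    u 0 ·ᵢ evalAtI (P 0) +ᵢ 0ᵢ
      ≡⟨ +ᵢ-identityʳ (u 0 ·ᵢ evalAtI (P 0)) ⟩
    u 0 ·ᵢ evalAtI (P 0) ∎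
    where open ≡-Reasoning

  evalAtI-traceSubst : ∀ h m → evalAtI (traceSubst h m) ≡ coeff h 0 ·ᵢ evalAtI (X ^ₚ m)
  evalAtI-traceSubst h m =
    trans (evalAtI-lincomb m (coeff h) (traceTerm m) higher-terms-vanish)
          (cong (coeff h 0 ·ᵢ_) (trans (evalAtI-*ₚ (X ^ₚ m) (constₚ 1ℤ)) (*ᵢ-identityʳ (evalAtI (X ^ₚ m)))))
    where
    higher-terms-vanish : ∀ j → evalAtI (traceTerm m (suc j)) ≡ 0ᵢ
    higher-terms-vanish j = begin
      evalAtI ((X ^ₚ (m ∸ suc j)) *ₚ (X²+1 *ₚ (X²+1 ^ₚ j)))
        ≡⟨ evalAtI-*ₚ (X ^ₚ (m ∸ suc j)) (X²+1 *ₚ (X²+1 ^ₚ j)) ⟩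
      evalAtI (X ^ₚ (m ∸ suc j)) *ᵢ evalAtI (X²+1 *ₚ (X²+1 ^ₚ j))
        ≡⟨ cong (evalAtI (X ^ₚ (m ∸ suc j)) *ᵢ_)
                (trans (evalAtI-*ₚ X²+1 (X²+1 ^ₚ j)) (*ᵢ-zeroˡ (evalAtI (X²+1 ^ₚ j)))) ⟩
      evalAtI (X ^ₚ (m ∸ suc j)) *ᵢ 0ᵢ
        ≡⟨ *ᵢ-zeroʳ (evalAtI (X ^ₚ (m ∸ suc j))) ⟩
      0ᵢ ∎
      where open ≡-Reasoning

  evalAtI-X^-period : ∀ k → evalAtI (X ^ₚ (4 ℕ.+ k)) ≡ evalAtI (X ^ₚ k)
  evalAtI-X^-period k = begin
    evalAtI (X ^ₚ (4 ℕ.+ k))         ≡⟨ X^suc (3 ℕ.+ k) ⟩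
    i· evalAtI (X ^ₚ (3 ℕ.+ k))      ≡⟨ cong i·_ (X^suc (2 ℕ.+ k)) ⟩
    i· i· evalAtI (X ^ₚ (2 ℕ.+ k))   ≡⟨ cong (λ z → i· i· z) (X^suc (1 ℕ.+ k)) ⟩
    i· i· i· evalAtI (X ^ₚ (1 ℕ.+ k)) ≡⟨ cong (λ z → i· i· i· z) (X^suc k) ⟩
    i· i· i· i· evalAtI (X ^ₚ k)      ≡⟨ i·-period (evalAtI (X ^ₚ k)) ⟩
    evalAtI (X ^ₚ k) ∎
    where
    open ≡-Reasoning
    X^suc : ∀ k → evalAtI (X ^ₚ suc k) ≡ i· evalAtI (X ^ₚ k)
    X^suc k = trans (evalAtI-*ₚ X (X ^ₚ k)) (i-* (evalAtI (X ^ₚ k)))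
      where
      i-* : ∀ z → (0ℤ , 1ℤ) *ᵢ z ≡ i· z
      i-* (a , b) = cong₂ _,_ (solve (a ∷ b ∷ [])) (solve (a ∷ b ∷ []))

  evalAtI-gpoly-period : ∀ n → evalAtI (gpoly (4 ℕ.+ n)) ≡ evalAtI (gpoly n)
  evalAtI-gpoly-period n = 1+i·-period (evalAtI (gpoly n))

  SignPattern : ℕ → ℤ → Set
  SignPattern r c = ((r ≡ 1 ⊎ r ≡ 3) → c ≡ 1ℤ) × ((r ≡ 5 ⊎ r ≡ 7) → c ≡ -1ℤ)

  odd-mod-8-period : ∀ k → (1 ℕ.+ 2 ℕ.* (4 ℕ.+ k)) % 8 ≡ (1 ℕ.+ 2 ℕ.* k) % 8
  odd-mod-8-period k = trans (cong (_% 8) (shift k)) ([m+n]%n≡m%n (1 ℕ.+ 2 ℕ.* k) 8)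
    where
    shift : ∀ k → 1 ℕ.+ 2 ℕ.* (4 ℕ.+ k) ≡ (1 ℕ.+ 2 ℕ.* k) ℕ.+ 8
    shift = ℕ-Solver.solve-∀

  gpoly-odd-period : ∀ k → gpoly (1 ℕ.+ 2 ℕ.* (4 ℕ.+ k)) ≡ gpoly (4 ℕ.+ (4 ℕ.+ (1 ℕ.+ 2 ℕ.* k)))
  gpoly-odd-period k = cong gpoly (shift k)
    where
    shift : ∀ k → 1 ℕ.+ 2 ℕ.* (4 ℕ.+ k) ≡ 4 ℕ.+ (4 ℕ.+ (1 ℕ.+ 2 ℕ.* k))
    shift = ℕ-Solver.solve-∀

  1≡c*1⇒c≡1 : ∀ {c} → 1ℤ ≡ c * 1ℤ → c ≡ 1ℤ
  1≡c*1⇒c≡1 {c} 1≡c = trans (sym (ℤₚ.*-identityʳ c)) (sym 1≡c)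

  1≡c*-1⇒c≡-1 : ∀ {c} → 1ℤ ≡ c * -1ℤ → c ≡ -1ℤ
  1≡c*-1⇒c≡-1 {c} 1≡-c = begin
    c            ≡⟨ ℤₚ.neg-involutive c ⟨
    - - c        ≡⟨ cong -_ (trans (ℤₚ.*-comm c -1ℤ) (ℤₚ.-1*i≡-i c)) ⟨
    - (c * -1ℤ)  ≡⟨ cong -_ 1≡-c ⟨
    -1ℤ          ∎
    where open ≡-Reasoning

  gpoly-at-i-sign : ∀ k c → evalAtI (gpoly (1 ℕ.+ 2 ℕ.* k)) ≡ c ·ᵢ evalAtI (X ^ₚ k) →
                   SignPattern ((1 ℕ.+ 2 ℕ.* k) % 8) c
  -- For k = 0, 1, 2, 3: g_{2k+1}(i) = 1, i, 1, i and i^k = 1, i, −1, −i.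
  gpoly-at-i-sign 0 c eq = (λ _ → 1≡c*1⇒c≡1 (cong proj₁ eq)) , λ { (inj₁ ()) ; (inj₂ ()) }
  gpoly-at-i-sign 1 c eq = (λ _ → 1≡c*1⇒c≡1 (cong proj₂ eq)) , λ { (inj₁ ()) ; (inj₂ ()) }
  gpoly-at-i-sign 2 c eq = (λ { (inj₁ ()) ; (inj₂ ()) }) , λ _ → 1≡c*-1⇒c≡-1 (cong proj₁ eq)
  gpoly-at-i-sign 3 c eq = (λ { (inj₁ ()) ; (inj₂ ()) }) , λ _ → 1≡c*-1⇒c≡-1 (cong proj₂ eq)
  gpoly-at-i-sign (suc (suc (suc (suc k)))) c eq =
    subst (λ r → SignPattern r c) (sym (odd-mod-8-period k)) (gpoly-at-i-sign k c (begin
      evalAtI (gpoly (1 ℕ.+ 2 ℕ.* k))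
        ≡⟨ trans (evalAtI-gpoly-period (4 ℕ.+ (1 ℕ.+ 2 ℕ.* k))) (evalAtI-gpoly-period (1 ℕ.+ 2 ℕ.* k)) ⟨
      evalAtI (gpoly (4 ℕ.+ (4 ℕ.+ (1 ℕ.+ 2 ℕ.* k))))
        ≡⟨ cong evalAtI (gpoly-odd-period k) ⟨
      evalAtI (gpoly (1 ℕ.+ 2 ℕ.* (4 ℕ.+ k)))
        ≡⟨ eq ⟩
      c ·ᵢ evalAtI (X ^ₚ (4 ℕ.+ k))
        ≡⟨ cong (c ·ᵢ_) (evalAtI-X^-period k) ⟩
      c ·ᵢ evalAtI (X ^ₚ k) ∎))
    where open ≡-Reasoning

module ResultantWithLinearPolynomial where
  open import Data.Integer using (_+_; _*_)

  horner : Poly → ℤ → ℤ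
  horner []      c = 0ℤ
  horner (a ∷ p) c = a + c * horner p c

  horner-zero : ∀ p → horner p 0ℤ ≡ coeff p 0
  horner-zero []      = refl
  horner-zero (a ∷ p) = trans (cong (a +_) (ℤₚ.*-zeroˡ (horner p 0ℤ))) (ℤₚ.+-identityʳ a)

  det-1×1 : (A : Mat 1) → det A ≡ A zero zero
  det-1×1 A = expand (A zero zero)
    where
    expand : ∀ a → 1ℤ * (a * 1ℤ) + 0ℤ ≡ a
    expand = solve-∀

  evalMat-1×1 : ∀ p (A : Mat 1) → evalMat p A zero zero ≡ horner p (A zero zero)
  evalMat-1×1 []      A = refl
  evalMat-1×1 (a ∷ p) A =
    cong (a +_) (trans (ℤₚ.+-identityʳ (A zero zero * evalMat p A zero zero))
                       (cong (A zero zero *_) (evalMat-1×1 p A)))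

  Res-linear : ∀ t s → Res t 1 s ≡ horner s (- coeff t 0)
  Res-linear t s = begin
    det (evalMat s (companion t 1))            ≡⟨ det-1×1 (evalMat s (companion t 1)) ⟩
    evalMat s (companion t 1) zero zero        ≡⟨ evalMat-1×1 s (companion t 1) ⟩
    horner s (0ℤ + - coeff t 0)                ≡⟨ cong (horner s) (ℤₚ.+-identityˡ (- coeff t 0)) ⟩
    horner s (- coeff t 0)                     ∎
    where open ≡-Reasoning

  X-trace-Φ₄ : IsTracePoly Φ₄ 1 X
  X-trace-Φ₄ = ((λ ()) , λ { (suc (suc j)) _ → refl ; (suc zero) (s≤s ()) })
             , λ { zero → refl ; (suc zero) → refl ; (suc (suc zero)) → refl ; (suc (suc (suc k))) → refl }

  trace-Φ₄-const : ∀ {t} → IsTracePoly Φ₄ 1 t → coeff t 0 ≡ 0ℤ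
  trace-Φ₄-const {t} (_ , Φ₄≈) = trans (sym (linear-coeff (coeff t 0) (coeff t 1))) (sym (Φ₄≈ 1))
    where
    linear-coeff : ∀ a b → a * 1ℤ + b * 0ℤ ≡ a
    linear-coeff = solve-∀

  Res-trace-Φ₄ : ∀ t s → IsTracePoly Φ₄ 1 t → Res t 1 s ≡ coeff s 0
  Res-trace-Φ₄ t s t-trace = begin
    Res t 1 s                ≡⟨ Res-linear t s ⟩
    horner s (- coeff t 0)   ≡⟨ cong (λ c → horner s (- c)) (trace-Φ₄-const {t} t-trace) ⟩
    horner s 0ℤ              ≡⟨ horner-zero s ⟩
    coeff s 0                ∎
    where open ≡-Reasoning

open import Data.Nat using (_+_; _*_)
open PolynomialAlgebra using (coeffwise; coeff-≡)
open TracePolynomialOfGeometricSum using (geomTrace; Monic⇒HasDegree; geomTrace-monic; geomTrace-trace)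
open EvaluationAtI using (evalAtI-cong; evalAtI-traceSubst; SignPattern; gpoly-at-i-sign)
open ResultantWithLinearPolynomial using (X-trace-Φ₄; Res-trace-Φ₄)

gpoly-trace-constant-sign : ∀ k s → gpoly (1 + 2 * k) ≈ₚ traceSubst s k →
                            SignPattern ((1 + 2 * k) % 8) (coeff s 0)
gpoly-trace-constant-sign k s g≈ =
  gpoly-at-i-sign k (coeff s 0)
    (trans (evalAtI-cong {gpoly (1 + 2 * k)} {traceSubst s k} (coeffwise g≈)) (evalAtI-traceSubst s k))

proposition4p2 : (k : ℕ) →
    (∃ λ t → IsTracePoly Φ₄ 1 t) × (∃ λ s → IsTracePoly (gpoly (1 + 2 * k)) k s) ×
    (∀ t s → IsTracePoly Φ₄ 1 t → IsTracePoly (gpoly (1 + 2 * k)) k s →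
      (((1 + 2 * k) % 8 ≡ 1 ⊎ (1 + 2 * k) % 8 ≡ 3) → Res t 1 s ≡ 1ℤ) ×
      (((1 + 2 * k) % 8 ≡ 5 ⊎ (1 + 2 * k) % 8 ≡ 7) → Res t 1 s ≡ -1ℤ))
proposition4p2 k =
    (X , X-trace-Φ₄)
  , (geomTrace k , Monic⇒HasDegree {geomTrace k} (geomTrace-monic k) , coeff-≡ (geomTrace-trace k))
  , λ t s t-trace s-trace →
      let Res≡s₀ = Res-trace-Φ₄ t s t-trace
          (s₀≡1 , s₀≡-1) = gpoly-trace-constant-sign k s (proj₂ s-trace)
      in (λ r → trans Res≡s₀ (s₀≡1 r)) , (λ r → trans Res≡s₀ (s₀≡-1 r))
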